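{- The class of SOS-Rayleigh matroids is minor-closed.
   Context: For a matroid $M$ with set of bases $\mathcal{B}$, its basis generating polynomial is $h_M=\sum_{B\in\mathcal{B}}\prod_{i\in B}x_i$. For a multiaffine $h\in\mathbb{R}[x_1,\dots,x_n]$ the Rayleigh difference is $\Delta_{ij}(h)=\frac{\partial h}{\partial x_i}\frac{\partial h}{\partial x_j}-\frac{\partial^2 h}{\partial x_i\partial x_j}h$; $h$ is SOS-Rayleigh if every $\Delta_{ij}(h)$, $1\le i,j\le n$, is a sum of squares of polynomials. A matroid is SOS-Rayleigh if its basis generating polynomial is SOS-Rayleigh. -}

module Defs where

open import Level using (Level; _⊔_) renaming (suc to lsuc)
open import Algebra.Bundles using (CommutativeRing)
open import Data.Nat using (ℕ; zero; suc)
open import Data.Fin using (Fin; zero; suc)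
open import Data.Fin.Subset using (Subset; _∈_; _∉_)
open import Data.Fin.Subset.Properties using (_∈?_)
open import Data.Bool using (Bool; true; false; if_then_else_)
open import Data.Vec using (Vec; []; _∷_; removeAt; _[_]≔_)
open import Data.List using (List; []; _∷_; map; foldr; filter; allFin)
open import Data.List.Relation.Unary.All using (All; all?)
open import Data.List.Relation.Unary.Unique.Propositional using (Unique)
import Data.List.Membership.Propositional as LM
open import Data.Product using (Σ; ∃; _×_; _,_)
open import Data.Unit.Polymorphic using (⊤)
open import Data.Sum using (_⊎_)
open import Relation.Nullary using (¬_; does; ¬?)


-- The real numbers: an arbitrary complete (Dedekind) ordered field,
-- i.e. ℝ up to isomorphism, given as a commutative ring with extra
-- structure.

record IsRealField {c ℓ} (R : CommutativeRing c ℓ) : Set (lsuc (c ⊔ ℓ)) where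
  open CommutativeRing R
  field
    _≤_        : Carrier → Carrier → Set ℓ
    ≤-refl     : ∀ {x} → x ≤ x
    ≤-trans    : ∀ {x y z} → x ≤ y → y ≤ z → x ≤ z
    ≤-antisym  : ∀ {x y} → x ≤ y → y ≤ x → x ≈ y
    ≤-total    : ∀ x y → (x ≤ y) ⊎ (y ≤ x)
    ≤-resp-≈   : ∀ {x x′ y y′} → x ≈ x′ → y ≈ y′ → x ≤ y → x′ ≤ y′
    +-mono-≤   : ∀ {x y} z → x ≤ y → (x + z) ≤ (y + z)
    *-nonneg   : ∀ {x y} → 0# ≤ x → 0# ≤ y → 0# ≤ (x * y)
    0≉1        : ¬ (0# ≈ 1#)
    inverse    : ∀ x → ¬ (x ≈ 0#) → ∃ λ y → (x * y) ≈ 1#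
    complete   : (P : Carrier → Set ℓ) → (∃ λ x → P x) →
                 (∃ λ b → ∀ x → P x → x ≤ b) →
                 ∃ λ s → (∀ x → P x → x ≤ s) ×
                         (∀ b → (∀ x → P x → x ≤ b) → s ≤ b)

-- Polynomials in n variables x₀,…,x_{n-1} over a commutative ring,
-- represented recursively: Poly (suc n) = lists of coefficients
-- (in Poly n, the variables x₁..x_n) of powers of the variable x₀.

module Polynomials {c ℓ} (R : CommutativeRing c ℓ) where
  open CommutativeRing R

  Poly : ℕ → Set c
  Poly zero    = Carrier
  Poly (suc n) = List (Poly n)

  0P : ∀ n → Poly n
  0P zero    = 0#
  0P (suc n) = []

  1P : ∀ n → Poly n
  1P zero    = 1#
  1P (suc n) = 1P n ∷ []

  addP : ∀ n → Poly n → Poly n → Poly n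
  addP zero    a       b       = a + b
  addP (suc n) []      q       = q
  addP (suc n) (a ∷ p) []      = a ∷ p
  addP (suc n) (a ∷ p) (b ∷ q) = addP n a b ∷ addP (suc n) p q

  negP : ∀ n → Poly n → Poly n
  negP zero    a       = - a
  negP (suc n) []      = []
  negP (suc n) (a ∷ p) = negP n a ∷ negP (suc n) p

  mulP : ∀ n → Poly n → Poly n → Poly n
  mulP zero    a       b = a * b
  mulP (suc n) []      q = []
  mulP (suc n) (a ∷ p) q = addP (suc n) (scale q) (0P n ∷ mulP (suc n) p q)
    where
    scale : Poly (suc n) → Poly (suc n)
    scale []      = []
    scale (b ∷ r) = mulP n a b ∷ scale r

  sumP : ∀ n → List (Poly n) → Poly n
  sumP n = foldr (addP n) (0P n)

  prodP : ∀ n → List (Poly n) → Poly n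
  prodP n = foldr (mulP n) (1P n)

  var : ∀ {n} → Fin n → Poly n
  var {suc n} zero    = 0P n ∷ 1P n ∷ []
  var {suc n} (suc i) = var i ∷ []

  natMul : ∀ n → ℕ → Poly n → Poly n
  natMul n zero    a = 0P n
  natMul n (suc k) a = addP n a (natMul n k a)

  ∂ : ∀ {n} → Fin n → Poly n → Poly n
  ∂ {suc n} zero    []      = []
  ∂ {suc n} zero    (a ∷ p) = go 1 p
    where
    go : ℕ → List (Poly n) → List (Poly n)
    go k []      = []
    go k (b ∷ r) = natMul n k b ∷ go (suc k) r
  ∂ {suc n} (suc i) p       = map (∂ i) p

  -- equality of polynomials (coefficientwise, trailing zeros ignored)
  EqP : ∀ n → Poly n → Poly n → Set ℓ
  EqP zero    a       b       = a ≈ b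
  EqP (suc n) []      []      = ⊤
  EqP (suc n) []      (b ∷ q) = EqP n (0P n) b × EqP (suc n) [] q
  EqP (suc n) (a ∷ p) []      = EqP n a (0P n) × EqP (suc n) p []
  EqP (suc n) (a ∷ p) (b ∷ q) = EqP n a b × EqP (suc n) p q

  IsSOS : ∀ {n} → Poly n → Set (c ⊔ ℓ)
  IsSOS {n} p = Σ (List (Poly n)) λ qs →
                  EqP n p (sumP n (map (λ q → mulP n q q) qs))

  Δ : ∀ {n} → Fin n → Fin n → Poly n → Poly n
  Δ {n} i j h = addP n (mulP n (∂ i h) (∂ j h))
                       (negP n (mulP n (∂ i (∂ j h)) h))

  SOSRayleigh : ∀ n → Poly n → Set (c ⊔ ℓ)
  SOSRayleigh n h = ∀ (i j : Fin n) → IsSOS {n} (Δ i j h)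

-- Matroids on the ground set Fin n, given by their list of bases.

elements : ∀ {n} → Subset n → List (Fin n)
elements {n} B = filter (_∈? B) (allFin n)

_∈L_ : ∀ {n} → Subset n → List (Subset n) → Set
_∈L_ = LM._∈_

record IsMatroid {n} (bases : List (Subset n)) : Set where
  field
    distinct : Unique bases
    nonempty : ∃ λ B → B ∈L bases
    exchange : ∀ B₁ B₂ → B₁ ∈L bases → B₂ ∈L bases →
               ∀ x → x ∈ B₁ → x ∉ B₂ →
               ∃ λ y → y ∈ B₂ × y ∉ B₁ ×
                       (((B₁ [ x ]≔ false) [ y ]≔ true) ∈L bases)

-- deletion M \ e  (if e is a coloop, M \ e = M / e)
deletion : ∀ {n} → Fin (suc n) → List (Subset (suc n)) → List (Subset n)
deletion e bs =
  map (λ B → removeAt B e)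
      (if does (all? (e ∈?_) bs) then bs else filter (λ B → ¬? (e ∈? B)) bs)

-- contraction M / e  (if e is a loop, M / e = M \ e)
contraction : ∀ {n} → Fin (suc n) → List (Subset (suc n)) → List (Subset n)
contraction e bs =
  map (λ B → removeAt B e)
      (if does (all? (λ B → ¬? (e ∈? B)) bs) then bs else filter (e ∈?_) bs)

-- Minor N M : N is obtained from M by a sequence of deletions and
-- contractions (ground set relabelled order-preservingly)
data Minor : ∀ {m n} → List (Subset m) → List (Subset n) → Set where
  here     : ∀ {n} {M : List (Subset n)} → Minor M M
  delete   : ∀ {m n} {N : List (Subset m)} {M : List (Subset (suc n))}
             (e : Fin (suc n)) → Minor N (deletion e M) → Minor N M
  contract : ∀ {m n} {N : List (Subset m)} {M : List (Subset (suc n))}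
             (e : Fin (suc n)) → Minor N (contraction e M) → Minor N M

module BasisPolynomial {c ℓ} (R : CommutativeRing c ℓ) where
  open Polynomials R

  basisPoly : ∀ {n} → List (Subset n) → Poly n
  basisPoly {n} bs = sumP n (map (λ B → prodP n (map var (elements B))) bs)

  SOSRayleighMatroid : ∀ {n} → List (Subset n) → Set (c ⊔ ℓ)
  SOSRayleighMatroid {n} bs = SOSRayleigh n (basisPoly bs)

{-# OPTIONS --safe #-}
-- Minors arise by single deletions and contractions, so it suffices to
-- treat one element e.  Renaming x_e to x₀, the basis polynomial becomes
-- h = h₀ + x₀ h₁, where h₀ and h₁ are the basis polynomials of M \ e and
-- M / e (if e is a loop or a coloop then M \ e = M / e, and its basis
-- polynomial is whichever of h₀, h₁ is nonzero).
-- For i, j ≠ e, Δᵢⱼ(h) has degree at most 2 in x₀, with constant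
-- coefficient Δᵢⱼ(h₀) and x₀²-coefficient Δᵢⱼ(h₁).  Constant coefficients
-- of sums of squares are sums of squares.  Over a real field a sum of
-- squares Σ qₖ² of degree at most 2 in x₀ has every qₖ of degree at most
-- 1, so its x₀²-coefficient is the sum of the squares of the
-- x₀-coefficients of the qₖ.
module Submission where

open import Defs
open import Algebra.Bundles using (CommutativeRing)
open import Level using (_⊔_)
open import Data.Bool using (true; false; if_then_else_)
open import Data.Empty using (⊥-elim)
open import Data.Fin using (Fin; zero; suc; punchIn)
open import Data.Fin.Subset using (Subset)
open import Data.Fin.Subset.Properties using (_∈?_)
open import Data.List using (List; []; _∷_; map; length; filter; allFin)
import Data.List.Properties
open import Data.List.Membership.Propositional using (_∈_)
open import Data.List.Membership.Propositional.Properties using (∈-map⁺)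
open import Data.List.Relation.Unary.All using (all?)
open import Data.List.Relation.Unary.Any using (here; there)
open import Data.Nat using (ℕ; zero; suc; _+_; _∸_; _≤_; _<_; z≤n; s≤s)
import Data.Nat.Properties as ℕ
open import Data.Nat.ListAction using (sum)
open import Data.Product using (Σ; _×_; _,_; proj₁; proj₂)
open import Data.Sum using (_⊎_; inj₁; inj₂; [_,_]′)
open import Data.Unit.Polymorphic using (tt)
open import Data.Vec using ([]; _∷_; removeAt)
open import Function using (_∘_)
open import Relation.Binary.Bundles using (Setoid)
open import Relation.Binary.Definitions using (tri<; tri≈; tri>)
open import Relation.Binary.PropositionalEquality as ≡ using (_≡_; refl)
import Relation.Binary.Reasoning.Setoid as SetoidReasoning
open import Relation.Nullary using (¬_; yes; no; does; ¬?)

length≤sum-lengths : ∀ {a} {A : Set a} {xs : List A} {xss} → xs ∈ xss → length xs ≤ sum (map length xss)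
length≤sum-lengths {xs = xs} (here refl) = ℕ.m≤m+n (length xs) _
length≤sum-lengths {xss = ys ∷ _} (there xs∈) = ℕ.≤-trans (length≤sum-lengths xs∈) (ℕ.m≤n+m _ (length ys))

module _ {c ℓ} (R : CommutativeRing c ℓ) where
  open Polynomials R
  open BasisPolynomial R using (basisPoly; SOSRayleighMatroid)
  private module CR = CommutativeRing R

  -- Ring laws of the recursive polynomial representation

  coefficient : ∀ n → ℕ → Poly (suc n) → Poly n
  coefficient n _       []      = 0P n
  coefficient n zero    (a ∷ p) = a
  coefficient n (suc m) (a ∷ p) = coefficient n m p

  -- EqP n is not injective in its arguments; the record wrapper lets Agda
  -- infer the two compared polynomials from an equation.
  record Eq (n : ℕ) (x y : Poly n) : Set ℓ where
    constructor ⟦_⟧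
    field ⟪_⟫ : EqP n x y
  open Eq public

  record PolyLaws (n : ℕ) : Set (c ⊔ ℓ) where
    field
      ≈-refl      : ∀ {x} → Eq n x x
      ≈-sym       : ∀ {x y} → Eq n x y → Eq n y x
      ≈-trans     : ∀ {x y z} → Eq n x y → Eq n y z → Eq n x z
      +-cong      : ∀ {x x′ y y′} → Eq n x x′ → Eq n y y′ → Eq n (addP n x y) (addP n x′ y′)
      neg-cong    : ∀ {x x′} → Eq n x x′ → Eq n (negP n x) (negP n x′)
      *-cong      : ∀ {x x′ y y′} → Eq n x x′ → Eq n y y′ → Eq n (mulP n x y) (mulP n x′ y′)
      +-assoc     : ∀ x y z → Eq n (addP n (addP n x y) z) (addP n x (addP n y z))
      +-comm      : ∀ x y → Eq n (addP n x y) (addP n y x)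
      +-identityˡ : ∀ x → Eq n (addP n (0P n) x) x
      neg-0       : Eq n (negP n (0P n)) (0P n)
      zeroˡ       : ∀ x → Eq n (mulP n (0P n) x) (0P n)
      zeroʳ       : ∀ x → Eq n (mulP n x (0P n)) (0P n)
      *-identityˡ : ∀ x → Eq n (mulP n (1P n) x) x
      ∂-cong      : ∀ (i : Fin n) {x y} → Eq n x y → Eq n (∂ i x) (∂ i y)
      ∂-+         : ∀ (i : Fin n) x y → Eq n (∂ i (addP n x y)) (addP n (∂ i x) (∂ i y))
      ∂-0         : ∀ (i : Fin n) → Eq n (∂ i (0P n)) (0P n)

  polyLaws-zero : PolyLaws zero
  polyLaws-zero = record
    { ≈-refl      = ⟦ CR.refl ⟧
    ; ≈-sym       = λ e → ⟦ CR.sym ⟪ e ⟫ ⟧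
    ; ≈-trans     = λ e f → ⟦ CR.trans ⟪ e ⟫ ⟪ f ⟫ ⟧
    ; +-cong      = λ e f → ⟦ CR.+-cong ⟪ e ⟫ ⟪ f ⟫ ⟧
    ; neg-cong    = λ e → ⟦ CR.-‿cong ⟪ e ⟫ ⟧
    ; *-cong      = λ e f → ⟦ CR.*-cong ⟪ e ⟫ ⟪ f ⟫ ⟧
    ; +-assoc     = λ x y z → ⟦ CR.+-assoc x y z ⟧
    ; +-comm      = λ x y → ⟦ CR.+-comm x y ⟧
    ; +-identityˡ = λ x → ⟦ CR.+-identityˡ x ⟧
    ; neg-0       = ⟦ CR.trans (CR.sym (CR.+-identityˡ (CR.- CR.0#))) (CR.-‿inverseʳ CR.0#) ⟧
    ; zeroˡ       = λ x → ⟦ CR.zeroˡ x ⟧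
    ; zeroʳ       = λ x → ⟦ CR.zeroʳ x ⟧
    ; *-identityˡ = λ x → ⟦ CR.*-identityˡ x ⟧
    ; ∂-cong      = λ ()
    ; ∂-+         = λ ()
    ; ∂-0         = λ ()
    }

  private
    tail : ∀ n → Poly (suc n) → Poly (suc n)
    tail n []      = []
    tail n (_ ∷ p) = p

  -- mulP and ∂ are defined with local helper functions that cannot be named
  -- directly.  Each helper is recovered as the solution of a unification
  -- problem against one unfolding of the function that uses it; the
  -- with-abstractions turn the helper's arguments into variables, so that
  -- the unique solution is the helper itself.
  mulP-helper : ∀ n (a : Poly n) (p : Poly (suc n)) →
    Σ (Poly (suc n) → Poly (suc n) → Poly (suc n)) λ scale →
      ∀ b d r → mulP (suc n) p (b ∷ d ∷ r) ≡ [] →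
      tail n (mulP (suc n) (a ∷ p) (b ∷ d ∷ r)) ≡ mulP n a d ∷ scale (b ∷ d ∷ r) r
  mulP-helper n a p = scale , unfolds
    where
    scale : Poly (suc n) → Poly (suc n) → Poly (suc n)
    scale = _
    unfolds : ∀ b d r → mulP (suc n) p (b ∷ d ∷ r) ≡ [] →
              tail n (mulP (suc n) (a ∷ p) (b ∷ d ∷ r)) ≡ mulP n a d ∷ scale (b ∷ d ∷ r) r
    unfolds b d r with Data.List._∷_ b (d ∷ r)
    ... | q with mulP (suc n) p q
    ...   | []    = λ _ → refl
    ...   | _ ∷ _ = λ ()

  ∂-helper : ∀ n (a : Poly n) →
    Σ (Poly (suc n) → ℕ → Poly (suc n) → Poly (suc n)) λ go →
      ∀ b r → ∂ {suc n} zero (a ∷ b ∷ r) ≡ natMul n 1 b ∷ go (b ∷ r) 2 r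
  ∂-helper n a = go , unfolds
    where
    go : Poly (suc n) → ℕ → Poly (suc n) → Poly (suc n)
    go = _
    unfolds : ∀ b r → ∂ {suc n} zero (a ∷ b ∷ r) ≡ natMul n 1 b ∷ go (b ∷ r) 2 r
    unfolds b r with Data.List._∷_ b r
    ... | q with 2
    ...   | k = refl

  scaleBy : ∀ n (a : Poly n) (p q : Poly (suc n)) → Poly (suc n) → Poly (suc n)
  scaleBy n a p = proj₁ (mulP-helper n a p)

  ∂-go : ∀ n (a : Poly n) (p : Poly (suc n)) → ℕ → Poly (suc n) → Poly (suc n)
  ∂-go n a = proj₁ (∂-helper n a)

  module Coefficients (n : ℕ) (L : PolyLaws n) where
    open PolyLaws L

    private
      _⊕_ = addP n
      _⊗_ = mulP n
      𝟘   = 0P n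
      _≈_ = Eq n
      infixl 6 _⊕_
      infixl 7 _⊗_
      infix  4 _≈_

    setoid : Setoid c ℓ
    setoid = record { Carrier = Poly n ; _≈_ = Eq n
                    ; isEquivalence = record { refl = ≈-refl ; sym = ≈-sym ; trans = ≈-trans } }

    ≈-reflexive : ∀ {x y} → x ≡ y → x ≈ y
    ≈-reflexive refl = ≈-refl

    +-identityʳ : ∀ x → x ⊕ 𝟘 ≈ x
    +-identityʳ x = ≈-trans (+-comm x 𝟘) (+-identityˡ x)

    +-interchange : ∀ a b c d → (a ⊕ b) ⊕ (c ⊕ d) ≈ (a ⊕ c) ⊕ (b ⊕ d)
    +-interchange a b c d =
      ≈-trans (+-assoc a b (c ⊕ d))
      (≈-trans (+-cong ≈-refl (≈-sym (+-assoc b c d)))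
      (≈-trans (+-cong ≈-refl (+-cong (+-comm b c) ≈-refl))
      (≈-trans (+-cong ≈-refl (+-assoc c b d))
      (≈-sym (+-assoc a c (b ⊕ d))))))

    coef : ℕ → Poly (suc n) → Poly n
    coef = coefficient n

    coef-ext : ∀ p q → (∀ m → coef m p ≈ coef m q) → Eq (suc n) p q
    coef-ext p q h = ⟦ go p q h ⟧
      where
      go : ∀ p q → (∀ m → coef m p ≈ coef m q) → EqP (suc n) p q
      go []      []      h = tt
      go []      (b ∷ q) h = ⟪ h zero ⟫ , go [] q (λ m → h (suc m))
      go (a ∷ p) []      h = ⟪ h zero ⟫ , go p [] (λ m → h (suc m))
      go (a ∷ p) (b ∷ q) h = ⟪ h zero ⟫ , go p q (λ m → h (suc m))

    coef-cong : ∀ {p q} → Eq (suc n) p q → ∀ m → coef m p ≈ coef m q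
    coef-cong {p} {q} e = go p q ⟪ e ⟫
      where
      go : ∀ p q → EqP (suc n) p q → ∀ m → coef m p ≈ coef m q
      go []      []      e       m       = ≈-refl
      go []      (b ∷ q) (e , _) zero    = ⟦ e ⟧
      go []      (b ∷ q) (_ , e) (suc m) = go [] q e m
      go (a ∷ p) []      (e , _) zero    = ⟦ e ⟧
      go (a ∷ p) []      (_ , e) (suc m) = go p [] e m
      go (a ∷ p) (b ∷ q) (e , _) zero    = ⟦ e ⟧
      go (a ∷ p) (b ∷ q) (_ , e) (suc m) = go p q e m

    sumUpTo : (ℕ → Poly n) → ℕ → Poly n
    sumUpTo f zero    = f zero
    sumUpTo f (suc m) = f zero ⊕ sumUpTo (λ a → f (suc a)) m

    sumUpTo-cong : ∀ {f g} m → (∀ a → f a ≈ g a) → sumUpTo f m ≈ sumUpTo g m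
    sumUpTo-cong zero    h = h zero
    sumUpTo-cong (suc m) h = +-cong (h zero) (sumUpTo-cong m (λ a → h (suc a)))

    sumUpTo-zero : ∀ {f} m → (∀ a → a ≤ m → f a ≈ 𝟘) → sumUpTo f m ≈ 𝟘
    sumUpTo-zero zero    h = h zero z≤n
    sumUpTo-zero (suc m) h =
      ≈-trans (+-cong (h zero z≤n) (sumUpTo-zero m (λ a a≤m → h (suc a) (s≤s a≤m)))) (+-identityˡ 𝟘)

    sumUpTo-single : ∀ {f} k m → k ≤ m → (∀ a → a ≤ m → ¬ a ≡ k → f a ≈ 𝟘) → sumUpTo f m ≈ f k
    sumUpTo-single zero    zero    _         h = ≈-refl
    sumUpTo-single zero    (suc m) _         h =
      ≈-trans (+-cong ≈-refl (sumUpTo-zero m (λ a a≤m → h (suc a) (s≤s a≤m) (λ ())))) (+-identityʳ _)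
    sumUpTo-single (suc k) (suc m) (s≤s k≤m) h =
      ≈-trans (+-cong (h zero z≤n (λ ()))
                      (sumUpTo-single k m k≤m (λ a a≤m a≢k → h (suc a) (s≤s a≤m) (a≢k ∘ ℕ.suc-injective))))
              (+-identityˡ _)

    sumUpTo-+ : ∀ {f g} m → sumUpTo (λ a → f a ⊕ g a) m ≈ sumUpTo f m ⊕ sumUpTo g m
    sumUpTo-+         zero    = ≈-refl
    sumUpTo-+ {f} {g} (suc m) = ≈-trans (+-cong ≈-refl (sumUpTo-+ m)) (+-interchange (f zero) (g zero) _ _)

    sumUpTo-comm : ∀ {f : ℕ → ℕ → Poly n} m₁ m₂ →
      sumUpTo (λ a → sumUpTo (f a) m₂) m₁ ≈ sumUpTo (λ b → sumUpTo (λ a → f a b) m₁) m₂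
    sumUpTo-comm     zero     m₂ = ≈-refl
    sumUpTo-comm {f} (suc m₁) m₂ =
      ≈-trans (+-cong ≈-refl (sumUpTo-comm {λ a → f (suc a)} m₁ m₂)) (≈-sym (sumUpTo-+ m₂))

    natMul-cong : ∀ k {a b} → a ≈ b → natMul n k a ≈ natMul n k b
    natMul-cong zero    e = ≈-refl
    natMul-cong (suc k) e = +-cong e (natMul-cong k e)

    natMul-0 : ∀ k → natMul n k 𝟘 ≈ 𝟘
    natMul-0 zero    = ≈-refl
    natMul-0 (suc k) = ≈-trans (+-cong ≈-refl (natMul-0 k)) (+-identityˡ 𝟘)

    natMul-+ : ∀ k a b → natMul n k (a ⊕ b) ≈ natMul n k a ⊕ natMul n k b
    natMul-+ zero    a b = ≈-sym (+-identityˡ 𝟘)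
    natMul-+ (suc k) a b = ≈-trans (+-cong ≈-refl (natMul-+ k a b)) (+-interchange a b _ _)

    coef-+ : ∀ m p q → coef m (addP (suc n) p q) ≈ coef m p ⊕ coef m q
    coef-+ m       []      q       = ≈-sym (+-identityˡ _)
    coef-+ m       (a ∷ p) []      = ≈-sym (+-identityʳ _)
    coef-+ zero    (a ∷ p) (b ∷ q) = ≈-refl
    coef-+ (suc m) (a ∷ p) (b ∷ q) = coef-+ m p q

    coef-neg : ∀ m p → coef m (negP (suc n) p) ≈ negP n (coef m p)
    coef-neg m       []      = ≈-sym neg-0
    coef-neg zero    (a ∷ p) = ≈-refl
    coef-neg (suc m) (a ∷ p) = coef-neg m p

    coef-scaleBy : ∀ a p q m r → coef m (scaleBy n a p q r) ≈ a ⊗ coef m r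
    coef-scaleBy a p q m       []      = ≈-sym (zeroʳ a)
    coef-scaleBy a p q zero    (b ∷ r) = ≈-refl
    coef-scaleBy a p q (suc m) (b ∷ r) = coef-scaleBy a p q m r

    coef-* : ∀ m p q → coef m (mulP (suc n) p q) ≈ sumUpTo (λ a → coef a p ⊗ coef (m ∸ a) q) m
    coef-* m       []      q = ≈-sym (sumUpTo-zero m (λ a _ → zeroˡ _))
    coef-* zero    (a ∷ p) q =
      ≈-trans (coef-+ zero (scaleBy n a p q q) (𝟘 ∷ mulP (suc n) p q))
              (≈-trans (+-cong (coef-scaleBy a p q zero q) ≈-refl) (+-identityʳ _))
    coef-* (suc m) (a ∷ p) q =
      ≈-trans (coef-+ (suc m) (scaleBy n a p q q) (𝟘 ∷ mulP (suc n) p q))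
              (+-cong (coef-scaleBy a p q (suc m) q) (coef-* m p q))

    coef-map : ∀ {k} (f : Poly k → Poly n) → f (0P k) ≈ 𝟘 →
               ∀ m p → coef m (map f p) ≈ f (coefficient k m p)
    coef-map         f f0 m       []      = ≈-sym f0
    coef-map         f f0 zero    (a ∷ p) = ≈-refl
    coef-map {k = k} f f0 (suc m) (a ∷ p) = coef-map {k} f f0 m p

    coef-∂-go : ∀ a p k r m → coef m (∂-go n a p k r) ≈ natMul n (k + m) (coef m r)
    coef-∂-go a p k []      m       = ≈-sym (natMul-0 (k + m))
    coef-∂-go a p k (b ∷ r) zero    = ≈-reflexive (≡.cong (λ t → natMul n t b) (≡.sym (ℕ.+-identityʳ k)))
    coef-∂-go a p k (b ∷ r) (suc m) =
      ≈-trans (coef-∂-go a p (suc k) r m)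
              (≈-reflexive (≡.cong (λ t → natMul n t (coef m r)) (≡.sym (ℕ.+-suc k m))))

    coef-∂-zero : ∀ m p → coef m (∂ {suc n} zero p) ≈ natMul n (suc m) (coef (suc m) p)
    coef-∂-zero m []      = ≈-sym (natMul-0 (suc m))
    coef-∂-zero m (a ∷ p) = coef-∂-go a p 1 p m

    coef-∂-suc : ∀ i m p → coef m (∂ {suc n} (suc i) p) ≈ ∂ i (coef m p)
    coef-∂-suc i = coef-map (∂ i) (∂-0 i)

    polyLaws-suc : PolyLaws (suc n)
    polyLaws-suc = record
      { ≈-refl      = λ {x} → coef-ext x x (λ _ → ≈-refl)
      ; ≈-sym       = λ {x} {y} e → coef-ext y x (λ m → ≈-sym (coef-cong e m))
      ; ≈-trans     = λ {x} {y} {z} e f → coef-ext x z (λ m → ≈-trans (coef-cong e m) (coef-cong f m))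
      ; +-cong      = +-cong′
      ; neg-cong    = neg-cong′
      ; *-cong      = *-cong′
      ; +-assoc     = +-assoc′
      ; +-comm      = λ x y → coef-ext (x ⊕′ y) (y ⊕′ x) (λ m →
                        ≈-trans (coef-+ m x y) (≈-trans (+-comm _ _) (≈-sym (coef-+ m y x))))
      ; +-identityˡ = λ x → coef-ext x x (λ _ → ≈-refl)
      ; neg-0       = ⟦ tt ⟧
      ; zeroˡ       = λ _ → ⟦ tt ⟧
      ; zeroʳ       = λ x → coef-ext (x ⊗′ []) [] (λ m → ≈-trans (coef-* m x []) (sumUpTo-zero m (λ _ _ → zeroʳ _)))
      ; *-identityˡ = *-identityˡ′
      ; ∂-cong      = ∂-cong′
      ; ∂-+         = ∂-+′
      ; ∂-0         = λ { zero → ⟦ tt ⟧ ; (suc i) → ⟦ tt ⟧ }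
      }
      where
      _⊕′_ = addP (suc n)
      _⊗′_ = mulP (suc n)

      +-cong′ : ∀ {x x′ y y′} → Eq (suc n) x x′ → Eq (suc n) y y′ → Eq (suc n) (x ⊕′ y) (x′ ⊕′ y′)
      +-cong′ {x} {x′} {y} {y′} e f = coef-ext (x ⊕′ y) (x′ ⊕′ y′) (λ m →
        ≈-trans (coef-+ m x y) (≈-trans (+-cong (coef-cong e m) (coef-cong f m)) (≈-sym (coef-+ m x′ y′))))

      neg-cong′ : ∀ {x x′} → Eq (suc n) x x′ → Eq (suc n) (negP (suc n) x) (negP (suc n) x′)
      neg-cong′ {x} {x′} e = coef-ext (negP (suc n) x) (negP (suc n) x′) (λ m →
        ≈-trans (coef-neg m x) (≈-trans (neg-cong (coef-cong e m)) (≈-sym (coef-neg m x′))))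

      *-cong′ : ∀ {x x′ y y′} → Eq (suc n) x x′ → Eq (suc n) y y′ → Eq (suc n) (x ⊗′ y) (x′ ⊗′ y′)
      *-cong′ {x} {x′} {y} {y′} e f = coef-ext (x ⊗′ y) (x′ ⊗′ y′) (λ m →
        ≈-trans (coef-* m x y)
        (≈-trans (sumUpTo-cong m (λ a → *-cong (coef-cong e a) (coef-cong f (m ∸ a))))
                 (≈-sym (coef-* m x′ y′))))

      +-assoc′ : ∀ x y z → Eq (suc n) ((x ⊕′ y) ⊕′ z) (x ⊕′ (y ⊕′ z))
      +-assoc′ x y z = coef-ext ((x ⊕′ y) ⊕′ z) (x ⊕′ (y ⊕′ z)) (λ m →
        ≈-trans (coef-+ m (x ⊕′ y) z)
        (≈-trans (+-cong (coef-+ m x y) ≈-refl)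
        (≈-trans (+-assoc _ _ _)
                 (≈-sym (≈-trans (coef-+ m x (y ⊕′ z)) (+-cong ≈-refl (coef-+ m y z)))))))

      *-identityˡ′ : ∀ x → Eq (suc n) ((1P n ∷ []) ⊗′ x) x
      *-identityˡ′ x = coef-ext ((1P n ∷ []) ⊗′ x) x (λ m →
        ≈-trans (coef-* m (1P n ∷ []) x)
        (≈-trans (sumUpTo-single 0 m z≤n (λ { zero _ 0≢0 → ⊥-elim (0≢0 refl) ; (suc a) _ _ → zeroˡ _ }))
                 (*-identityˡ (coef m x))))

      ∂-cong′ : ∀ (i : Fin (suc n)) {x y} → Eq (suc n) x y → Eq (suc n) (∂ i x) (∂ i y)
      ∂-cong′ zero    {x} {y} e = coef-ext (∂ {suc n} zero x) (∂ {suc n} zero y) (λ m →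
        ≈-trans (coef-∂-zero m x)
        (≈-trans (natMul-cong (suc m) (coef-cong e (suc m))) (≈-sym (coef-∂-zero m y))))
      ∂-cong′ (suc i) {x} {y} e = coef-ext (∂ {suc n} (suc i) x) (∂ {suc n} (suc i) y) (λ m →
        ≈-trans (coef-∂-suc i m x)
        (≈-trans (∂-cong i (coef-cong e m)) (≈-sym (coef-∂-suc i m y))))

      ∂-+′ : ∀ (i : Fin (suc n)) x y → Eq (suc n) (∂ i (x ⊕′ y)) (∂ i x ⊕′ ∂ i y)
      ∂-+′ zero    x y = coef-ext (∂ {suc n} zero (x ⊕′ y)) (∂ {suc n} zero x ⊕′ ∂ {suc n} zero y) (λ m →
        ≈-trans (coef-∂-zero m (x ⊕′ y))
        (≈-trans (natMul-cong (suc m) (coef-+ (suc m) x y))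
        (≈-trans (natMul-+ (suc m) _ _)
                 (≈-sym (≈-trans (coef-+ m (∂ {suc n} zero x) (∂ {suc n} zero y))
                                 (+-cong (coef-∂-zero m x) (coef-∂-zero m y)))))))
      ∂-+′ (suc i) x y = coef-ext (∂ {suc n} (suc i) (x ⊕′ y)) (∂ {suc n} (suc i) x ⊕′ ∂ {suc n} (suc i) y) (λ m →
        ≈-trans (coef-∂-suc i m (x ⊕′ y))
        (≈-trans (∂-cong i (coef-+ m x y))
        (≈-trans (∂-+ i _ _)
                 (≈-sym (≈-trans (coef-+ m (∂ {suc n} (suc i) x) (∂ {suc n} (suc i) y))
                                 (+-cong (coef-∂-suc i m x) (coef-∂-suc i m y)))))))

  polyLaws : ∀ n → PolyLaws n
  polyLaws zero    = polyLaws-zero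
  polyLaws (suc n) = Coefficients.polyLaws-suc n (polyLaws n)

  module PolyProps (n : ℕ) where
    open PolyLaws (polyLaws n) public
    open Coefficients n (polyLaws n) public

  coef-sumUpTo : ∀ n (g : ℕ → Poly (suc n)) k m →
    Eq n (PolyProps.coef n m (PolyProps.sumUpTo (suc n) g k)) (PolyProps.sumUpTo n (λ a → PolyProps.coef n m (g a)) k)
  coef-sumUpTo n g zero    m = PolyProps.≈-refl n
  coef-sumUpTo n g (suc k) m =
    PolyProps.≈-trans n (PolyProps.coef-+ n m (g zero) (PolyProps.sumUpTo (suc n) (λ a → g (suc a)) k))
                        (PolyProps.+-cong n (PolyProps.≈-refl n) (coef-sumUpTo n (λ a → g (suc a)) k m))

  coef-natMul : ∀ n k u m → Eq n (PolyProps.coef n m (natMul (suc n) k u)) (natMul n k (PolyProps.coef n m u))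
  coef-natMul n zero    u m = PolyProps.≈-refl n
  coef-natMul n (suc k) u m =
    PolyProps.≈-trans n (PolyProps.coef-+ n m u (natMul (suc n) k u))
                        (PolyProps.+-cong n (PolyProps.≈-refl n) (coef-natMul n k u m))

  -- Renaming variables

  record IsPolyHom (a b : ℕ) (f : Poly a → Poly b) : Set (c ⊔ ℓ) where
    field
      cong     : ∀ {x y} → Eq a x y → Eq b (f x) (f y)
      +-homo   : ∀ x y → Eq b (f (addP a x y)) (addP b (f x) (f y))
      -‿homo   : ∀ x → Eq b (f (negP a x)) (negP b (f x))
      *-homo   : ∀ x y → Eq b (f (mulP a x y)) (mulP b (f x) (f y))
      0#-homo  : Eq b (f (0P a)) (0P b)

  id-isPolyHom : ∀ a → IsPolyHom a a (λ x → x)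
  id-isPolyHom a = record
    { cong = λ e → e ; +-homo = λ _ _ → ≈-refl ; -‿homo = λ _ → ≈-refl
    ; *-homo = λ _ _ → ≈-refl ; 0#-homo = ≈-refl }
    where open PolyProps a

  ∘-isPolyHom : ∀ {a b d} {f : Poly a → Poly b} {g : Poly b → Poly d} →
                IsPolyHom a b f → IsPolyHom b d g → IsPolyHom a d (λ x → g (f x))
  ∘-isPolyHom {d = d} F G = record
    { cong    = λ e → G.cong (F.cong e)
    ; +-homo  = λ x y → ≈-trans (G.cong (F.+-homo x y)) (G.+-homo _ _)
    ; -‿homo  = λ x → ≈-trans (G.cong (F.-‿homo x)) (G.-‿homo _)
    ; *-homo  = λ x y → ≈-trans (G.cong (F.*-homo x y)) (G.*-homo _ _)
    ; 0#-homo = ≈-trans (G.cong F.0#-homo) G.0#-homo }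
    where
    module F = IsPolyHom F
    module G = IsPolyHom G
    open PolyProps d

  module _ {a b f} (F : IsPolyHom a b f) where
    open IsPolyHom F
    open PolyProps b

    hom-sumUpTo : ∀ g k → Eq b (f (PolyProps.sumUpTo a g k)) (sumUpTo (λ x → f (g x)) k)
    hom-sumUpTo g zero    = ≈-refl
    hom-sumUpTo g (suc k) = ≈-trans (+-homo _ _) (+-cong ≈-refl (hom-sumUpTo (λ x → g (suc x)) k))

    hom-natMul : ∀ k x → Eq b (f (natMul a k x)) (natMul b k (f x))
    hom-natMul zero    x = 0#-homo
    hom-natMul (suc k) x = ≈-trans (+-homo _ _) (+-cong ≈-refl (hom-natMul k x))

    hom-sumP : ∀ {l} {A : Set l} (g : A → Poly a) (xs : List A) →
               Eq b (f (sumP a (map g xs))) (sumP b (map (λ x → f (g x)) xs))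
    hom-sumP g []       = 0#-homo
    hom-sumP g (x ∷ xs) = ≈-trans (+-homo _ _) (+-cong ≈-refl (hom-sumP g xs))

  module _ {a b f} (F : IsPolyHom a b f) where
    private
      module F = IsPolyHom F
      module A = PolyProps a
      module B = PolyProps b
      coef-mapF : ∀ m p → Eq b (B.coef m (map f p)) (f (A.coef m p))
      coef-mapF = B.coef-map {a} f F.0#-homo

    map-isPolyHom : IsPolyHom (suc a) (suc b) (map f)
    map-isPolyHom = record
      { cong    = λ {x} {y} e → B.coef-ext (map f x) (map f y) (λ m →
          B.≈-trans (coef-mapF m x) (B.≈-trans (F.cong (A.coef-cong e m)) (B.≈-sym (coef-mapF m y))))
      ; +-homo  = map-+
      ; -‿homo  = map-neg
      ; *-homo  = map-*
      ; 0#-homo = ⟦ tt ⟧ }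
      where
      map-+ : ∀ x y → Eq (suc b) (map f (addP (suc a) x y)) (addP (suc b) (map f x) (map f y))
      map-+ x y = B.coef-ext (map f (addP (suc a) x y)) (addP (suc b) (map f x) (map f y)) (λ m →
        B.≈-trans (coef-mapF m (addP (suc a) x y))
        (B.≈-trans (F.cong (A.coef-+ m x y))
        (B.≈-trans (F.+-homo _ _)
                   (B.≈-sym (B.≈-trans (B.coef-+ m (map f x) (map f y))
                                       (B.+-cong (coef-mapF m x) (coef-mapF m y)))))))

      map-neg : ∀ x → Eq (suc b) (map f (negP (suc a) x)) (negP (suc b) (map f x))
      map-neg x = B.coef-ext (map f (negP (suc a) x)) (negP (suc b) (map f x)) (λ m →
        B.≈-trans (coef-mapF m (negP (suc a) x))
        (B.≈-trans (F.cong (A.coef-neg m x))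
        (B.≈-trans (F.-‿homo _)
                   (B.≈-sym (B.≈-trans (B.coef-neg m (map f x)) (B.neg-cong (coef-mapF m x)))))))

      map-* : ∀ x y → Eq (suc b) (map f (mulP (suc a) x y)) (mulP (suc b) (map f x) (map f y))
      map-* x y = B.coef-ext (map f (mulP (suc a) x y)) (mulP (suc b) (map f x) (map f y)) (λ m →
        B.≈-trans (coef-mapF m (mulP (suc a) x y))
        (B.≈-trans (F.cong (A.coef-* m x y))
        (B.≈-trans (hom-sumUpTo F _ m)
        (B.≈-trans (B.sumUpTo-cong m (λ k →
                      B.≈-trans (F.*-homo _ _) (B.*-cong (B.≈-sym (coef-mapF k x)) (B.≈-sym (coef-mapF (m ∸ k) y)))))
                   (B.≈-sym (B.coef-* m (map f x) (map f y)))))))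

  map-∂-zero : ∀ {a f} → IsPolyHom a a f → ∀ p →
               Eq (suc a) (map f (∂ {suc a} zero p)) (∂ {suc a} zero (map f p))
  map-∂-zero {a} {f} F p = A.coef-ext (map f (∂ {suc a} zero p)) (∂ {suc a} zero (map f p)) (λ m →
    A.≈-trans (coef-mapF m (∂ {suc a} zero p))
    (A.≈-trans (F.cong (A.coef-∂-zero m p))
    (A.≈-trans (hom-natMul F (suc m) _)
               (A.≈-sym (A.≈-trans (A.coef-∂-zero m (map f p)) (A.natMul-cong (suc m) (coef-mapF (suc m) p)))))))
    where
    module F = IsPolyHom F
    module A = PolyProps a
    coef-mapF : ∀ m p → Eq a (A.coef m (map f p)) (f (A.coef m p))
    coef-mapF = A.coef-map {a} f F.0#-homo

  zipCons : ∀ n → Poly (suc n) → Poly (suc (suc n)) → Poly (suc (suc n))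
  zipCons n []       cols         = map (0P n ∷_) cols
  zipCons n (x ∷ xs) []           = (x ∷ []) ∷ zipCons n xs []
  zipCons n (x ∷ xs) (col ∷ cols) = (x ∷ col) ∷ zipCons n xs cols

  swap₀₁ : ∀ n → Poly (suc (suc n)) → Poly (suc (suc n))
  swap₀₁ n []       = []
  swap₀₁ n (r ∷ rs) = zipCons n r (swap₀₁ n rs)

  module Swap (n : ℕ) where
    private
      module N  = PolyProps n
      module S  = PolyProps (suc n)
      swap = swap₀₁ n
      _⊕″_ = addP (suc (suc n))
      _⊗″_ = mulP (suc (suc n))

    coef₂ : ℕ → ℕ → Poly (suc (suc n)) → Poly n
    coef₂ i j p = N.coef j (S.coef i p)

    coef₂-ext : ∀ p q → (∀ i j → Eq n (coef₂ i j p) (coef₂ i j q)) → Eq (suc (suc n)) p q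
    coef₂-ext p q h = S.coef-ext p q (λ i → N.coef-ext (S.coef i p) (S.coef i q) (h i))

    coef₂-cong : ∀ {p q} → Eq (suc (suc n)) p q → ∀ i j → Eq n (coef₂ i j p) (coef₂ i j q)
    coef₂-cong e i j = N.coef-cong (S.coef-cong e i) j

    coef₂-zipCons-zero : ∀ r cols j → Eq n (coef₂ j 0 (zipCons n r cols)) (N.coef j r)
    coef₂-zipCons-zero []       []           j       = N.≈-refl
    coef₂-zipCons-zero []       (col ∷ cols) zero    = N.≈-refl
    coef₂-zipCons-zero []       (col ∷ cols) (suc j) = coef₂-zipCons-zero [] cols j
    coef₂-zipCons-zero (x ∷ xs) []           zero    = N.≈-refl
    coef₂-zipCons-zero (x ∷ xs) []           (suc j) = coef₂-zipCons-zero xs [] j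
    coef₂-zipCons-zero (x ∷ xs) (col ∷ cols) zero    = N.≈-refl
    coef₂-zipCons-zero (x ∷ xs) (col ∷ cols) (suc j) = coef₂-zipCons-zero xs cols j

    coef₂-zipCons-suc : ∀ r cols i j → Eq n (coef₂ j (suc i) (zipCons n r cols)) (coef₂ j i cols)
    coef₂-zipCons-suc []       []           i j       = N.≈-refl
    coef₂-zipCons-suc []       (col ∷ cols) i zero    = N.≈-refl
    coef₂-zipCons-suc []       (col ∷ cols) i (suc j) = coef₂-zipCons-suc [] cols i j
    coef₂-zipCons-suc (x ∷ xs) []           i zero    = N.≈-refl
    coef₂-zipCons-suc (x ∷ xs) []           i (suc j) = coef₂-zipCons-suc xs [] i j
    coef₂-zipCons-suc (x ∷ xs) (col ∷ cols) i zero    = N.≈-refl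
    coef₂-zipCons-suc (x ∷ xs) (col ∷ cols) i (suc j) = coef₂-zipCons-suc xs cols i j

    coef₂-swap : ∀ p i j → Eq n (coef₂ j i (swap p)) (coef₂ i j p)
    coef₂-swap []       i       j = N.≈-refl
    coef₂-swap (r ∷ rs) zero    j = coef₂-zipCons-zero r (swap rs) j
    coef₂-swap (r ∷ rs) (suc i) j = N.≈-trans (coef₂-zipCons-suc r (swap rs) i j) (coef₂-swap rs i j)

    swap-ext : ∀ p q → (∀ i j → Eq n (coef₂ i j p) (coef₂ i j q)) → Eq (suc (suc n)) (swap p) (swap q)
    swap-ext p q h = coef₂-ext (swap p) (swap q) (λ i j →
      N.≈-trans (coef₂-swap p j i) (N.≈-trans (h j i) (N.≈-sym (coef₂-swap q j i))))

    coef₂-* : ∀ x y i j → Eq n (coef₂ i j (x ⊗″ y))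
      (N.sumUpTo (λ a → N.sumUpTo (λ b → mulP n (coef₂ a b x) (coef₂ (i ∸ a) (j ∸ b) y)) j) i)
    coef₂-* x y i j = N.≈-trans (N.coef-cong (S.coef-* i x y) j)
      (N.≈-trans (coef-sumUpTo n _ i j) (N.sumUpTo-cong i (λ a → N.coef-* j (S.coef a x) (S.coef (i ∸ a) y))))

    swap-+ : ∀ x y → Eq (suc (suc n)) (swap (x ⊕″ y)) (swap x ⊕″ swap y)
    swap-+ x y = coef₂-ext (swap (x ⊕″ y)) (swap x ⊕″ swap y) (λ i j →
      N.≈-trans (coef₂-swap (x ⊕″ y) j i)
      (N.≈-trans (N.coef-cong (S.coef-+ j x y) i)
      (N.≈-trans (N.coef-+ i (S.coef j x) (S.coef j y))
      (N.≈-sym (N.≈-trans (N.coef-cong (S.coef-+ i (swap x) (swap y)) j)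
               (N.≈-trans (N.coef-+ j (S.coef i (swap x)) (S.coef i (swap y)))
                          (N.+-cong (coef₂-swap x j i) (coef₂-swap y j i))))))))

    swap-neg : ∀ x → Eq (suc (suc n)) (swap (negP (suc (suc n)) x)) (negP (suc (suc n)) (swap x))
    swap-neg x = coef₂-ext (swap (negP (suc (suc n)) x)) (negP (suc (suc n)) (swap x)) (λ i j →
      N.≈-trans (coef₂-swap (negP (suc (suc n)) x) j i)
      (N.≈-trans (N.coef-cong (S.coef-neg j x) i)
      (N.≈-trans (N.coef-neg i (S.coef j x))
      (N.≈-sym (N.≈-trans (N.coef-cong (S.coef-neg i (swap x)) j)
               (N.≈-trans (N.coef-neg j (S.coef i (swap x)))
                          (N.neg-cong (coef₂-swap x j i))))))))

    swap-* : ∀ x y → Eq (suc (suc n)) (swap (x ⊗″ y)) (swap x ⊗″ swap y)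
    swap-* x y = coef₂-ext (swap (x ⊗″ y)) (swap x ⊗″ swap y) (λ i j →
      N.≈-trans (coef₂-swap (x ⊗″ y) j i)
      (N.≈-trans (coef₂-* x y j i)
      (N.≈-trans (N.sumUpTo-comm j i)
      (N.≈-sym (N.≈-trans (coef₂-* (swap x) (swap y) i j)
               (N.sumUpTo-cong i (λ a → N.sumUpTo-cong j (λ b →
                  N.*-cong (coef₂-swap x b a) (coef₂-swap y (j ∸ b) (i ∸ a))))))))))

    swap-isPolyHom : IsPolyHom (suc (suc n)) (suc (suc n)) swap
    swap-isPolyHom = record
      { cong    = λ {x} {y} e → swap-ext x y (coef₂-cong e)
      ; +-homo  = swap-+
      ; -‿homo  = swap-neg
      ; *-homo  = swap-*
      ; 0#-homo = ⟦ tt ⟧ }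

    swap-∂-zero : ∀ p → Eq (suc (suc n)) (swap (∂ {suc (suc n)} zero p)) (∂ {suc (suc n)} (suc zero) (swap p))
    swap-∂-zero p = coef₂-ext _ _ (λ i j →
      N.≈-trans (coef₂-swap (∂ {suc (suc n)} zero p) j i)
      (N.≈-trans (N.coef-cong (S.coef-∂-zero j p) i)
      (N.≈-trans (coef-natMul n (suc j) (S.coef (suc j) p) i)
      (N.≈-sym (N.≈-trans (N.coef-cong (S.coef-∂-suc zero i (swap p)) j)
               (N.≈-trans (N.coef-∂-zero j (S.coef i (swap p)))
                          (N.natMul-cong (suc j) (coef₂-swap p (suc j) i))))))))

    swap-∂-suc-suc : ∀ k p → Eq (suc (suc n)) (swap (∂ {suc (suc n)} (suc (suc k)) p)) (∂ (suc (suc k)) (swap p))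
    swap-∂-suc-suc k p = coef₂-ext _ _ (λ i j →
      N.≈-trans (coef₂-swap (∂ {suc (suc n)} (suc (suc k)) p) j i)
      (N.≈-trans (N.coef-cong (S.coef-∂-suc (suc k) j p) i)
      (N.≈-trans (N.coef-∂-suc k i (S.coef j p))
      (N.≈-sym (N.≈-trans (N.coef-cong (S.coef-∂-suc (suc k) i (swap p)) j)
               (N.≈-trans (N.coef-∂-suc k j (S.coef i (swap p)))
                          (N.∂-cong k (coef₂-swap p j i))))))))

  -- toFront e renames the variables so that x_e becomes x₀, the others
  -- keeping their order (x_{punchIn e i} becomes x_{suc i}).
  toFront : ∀ {n} → Fin (suc n) → Poly (suc n) → Poly (suc n)
  toFront         zero    p = p
  toFront {suc n} (suc e) p = swap₀₁ n (map (toFront e) p)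

  toFront-isPolyHom : ∀ {n} (e : Fin (suc n)) → IsPolyHom (suc n) (suc n) (toFront e)
  toFront-isPolyHom {n}     zero    = id-isPolyHom (suc n)
  toFront-isPolyHom {suc n} (suc e) = ∘-isPolyHom (map-isPolyHom (toFront-isPolyHom e)) (Swap.swap-isPolyHom n)

  toFront-∂ : ∀ {n} (e : Fin (suc n)) (i : Fin n) p →
              Eq (suc n) (toFront e (∂ (punchIn e i) p)) (∂ (suc i) (toFront e p))
  toFront-∂ {n}     zero    i       p = PolyProps.≈-refl (suc n)
  toFront-∂ {suc n} (suc e) zero    p =
    PolyProps.≈-trans (suc (suc n)) (IsPolyHom.cong (Swap.swap-isPolyHom n) (map-∂-zero (toFront-isPolyHom e) p))
                                    (Swap.swap-∂-zero n (map (toFront e) p))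
  toFront-∂ {suc n} (suc e) (suc i) p =
    PolyProps.≈-trans (suc (suc n)) (IsPolyHom.cong (Swap.swap-isPolyHom n) inner)
                                    (Swap.swap-∂-suc-suc n i (map (toFront e) p))
    where
    module S = PolyProps (suc n)
    module F = IsPolyHom (toFront-isPolyHom e)
    coef-mapF : ∀ m p → Eq (suc n) (S.coef m (map (toFront e) p)) (toFront e (S.coef m p))
    coef-mapF = S.coef-map {suc n} (toFront e) F.0#-homo
    ∂ᵢₑ : Poly (suc (suc n)) → Poly (suc (suc n))
    ∂ᵢₑ = ∂ {suc (suc n)} (suc (punchIn e i))
    inner : Eq (suc (suc n)) (map (toFront e) (∂ᵢₑ p)) (∂ {suc (suc n)} (suc (suc i)) (map (toFront e) p))
    inner = S.coef-ext (map (toFront e) (∂ᵢₑ p)) (∂ {suc (suc n)} (suc (suc i)) (map (toFront e) p)) (λ m →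
      S.≈-trans (coef-mapF m (∂ᵢₑ p))
      (S.≈-trans (F.cong (S.coef-∂-suc (punchIn e i) m p))
      (S.≈-trans (toFront-∂ e i (S.coef m p))
                 (S.≈-sym (S.≈-trans (S.coef-∂-suc (suc i) m (map (toFront e) p))
                                     (S.∂-cong (suc i) (coef-mapF m p)))))))

  Δ-cong : ∀ n (i j : Fin n) {p q} → Eq n p q → Eq n (Δ i j p) (Δ i j q)
  Δ-cong n i j e = +-cong (*-cong (∂-cong i e) (∂-cong j e)) (neg-cong (*-cong (∂-cong i (∂-cong j e)) e))
    where open PolyProps n

  toFront-Δ : ∀ {n} (e : Fin (suc n)) (i j : Fin n) h →
    Eq (suc n) (toFront e (Δ (punchIn e i) (punchIn e j) h)) (Δ (suc i) (suc j) (toFront e h))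
  toFront-Δ {n} e i j h =
    ≈-trans (F.+-homo (mulP (suc n) hᵢ hⱼ) (negP (suc n) (mulP (suc n) hᵢⱼ h)))
    (+-cong (≈-trans (F.*-homo hᵢ hⱼ) (*-cong (toFront-∂ e i h) (toFront-∂ e j h)))
            (≈-trans (F.-‿homo (mulP (suc n) hᵢⱼ h))
                     (neg-cong (≈-trans (F.*-homo hᵢⱼ h)
                                        (*-cong (≈-trans (toFront-∂ e i hⱼ) (∂-cong (suc i) (toFront-∂ e j h))) ≈-refl)))))
    where
    open PolyProps (suc n)
    module F = IsPolyHom (toFront-isPolyHom e)
    hᵢ  = ∂ (punchIn e i) h
    hⱼ  = ∂ (punchIn e j) h
    hᵢⱼ = ∂ (punchIn e i) hⱼ

  -- Sums of squares and coefficients in the outermost variable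

  sumOfSquares : ∀ n → List (Poly n) → Poly n
  sumOfSquares n qs = sumP n (map (λ q → mulP n q q) qs)

  module _ (n : ℕ) where
    open PolyProps n

    sumP-cong : ∀ {l} {A : Set l} {f g : A → Poly n} xs → (∀ {x} → x ∈ xs → Eq n (f x) (g x)) →
                Eq n (sumP n (map f xs)) (sumP n (map g xs))
    sumP-cong []       h = ≈-refl
    sumP-cong (x ∷ xs) h = +-cong (h (here refl)) (sumP-cong xs (h ∘ there))

    sumP-zero : ∀ {l} {A : Set l} {f : A → Poly n} xs → (∀ {x} → x ∈ xs → Eq n (f x) (0P n)) →
                Eq n (sumP n (map f xs)) (0P n)
    sumP-zero []       h = ≈-refl
    sumP-zero (x ∷ xs) h = ≈-trans (+-cong (h (here refl)) (sumP-zero xs (h ∘ there))) (+-identityˡ (0P n))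

    coef-sumP : ∀ {l} {A : Set l} (f : A → Poly (suc n)) xs m →
                Eq n (coef m (sumP (suc n) (map f xs))) (sumP n (map (λ x → coef m (f x)) xs))
    coef-sumP f []       m = ≈-refl
    coef-sumP f (x ∷ xs) m = ≈-trans (coef-+ m (f x) _) (+-cong ≈-refl (coef-sumP f xs m))

  sumOfSquares-map : ∀ a n (f : Poly a → Poly n) qs →
                     sumP n (map (λ q → mulP n (f q) (f q)) qs) ≡ sumOfSquares n (map f qs)
  sumOfSquares-map a n f qs = ≡.cong (sumP n) (Data.List.Properties.map-∘ qs)

  IsSOS-resp : ∀ n {p q} → Eq n p q → IsSOS {n} q → IsSOS {n} p
  IsSOS-resp n p≈q (qs , q≈) = qs , ⟪ PolyProps.≈-trans n p≈q ⟦ q≈ ⟧ ⟫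

  hom-IsSOS : ∀ {a b f} → IsPolyHom a b f → ∀ {p} → IsSOS {a} p → IsSOS {b} (f p)
  hom-IsSOS {a} {b} {f} F (qs , p≈) = map f qs , ⟪
    ≈-trans (IsPolyHom.cong F ⟦ p≈ ⟧)
    (≈-trans (hom-sumP F (λ q → mulP a q q) qs)
    (≈-trans (sumP-cong b qs (λ {q} _ → IsPolyHom.*-homo F q q))
             (≈-reflexive (sumOfSquares-map a b f qs)))) ⟫
    where open PolyProps b

  toFront-Δ-IsSOS : ∀ {n} (e : Fin (suc n)) h → SOSRayleigh (suc n) h →
                    ∀ (i j : Fin n) → IsSOS {suc n} (Δ (suc i) (suc j) (toFront e h))
  toFront-Δ-IsSOS {n} e h sos i j =
    IsSOS-resp (suc n) (PolyProps.≈-sym (suc n) (toFront-Δ e i j h))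
                       (hom-IsSOS (toFront-isPolyHom e) (sos (punchIn e i) (punchIn e j)))

  FormallyReal : ℕ → Set (c ⊔ ℓ)
  FormallyReal n = ∀ qs → Eq n (sumOfSquares n qs) (0P n) → ∀ {q} → q ∈ qs → Eq n q (0P n)

  module Degree (n : ℕ) where
    open PolyProps n
    open SetoidReasoning setoid

    private
      _⊗_  = mulP n
      _⊗′_ = mulP (suc n)
      𝟘    = 0P n

    HasDegree≤ : ℕ → Poly (suc n) → Set ℓ
    HasDegree≤ d p = ∀ j → d < j → Eq n (coef j p) 𝟘

    VanishesBelow : ℕ → Poly (suc n) → Set ℓ
    VanishesBelow d p = ∀ j → j < d → Eq n (coef j p) 𝟘

    coef-*-single : ∀ d e x y → (∀ a → a ≤ d + e → ¬ a ≡ d → Eq n (coef a x) 𝟘 ⊎ Eq n (coef (d + e ∸ a) y) 𝟘) →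
                    Eq n (coef (d + e) (x ⊗′ y)) (coef d x ⊗ coef e y)
    coef-*-single d e x y h = ≈-trans (coef-* (d + e) x y)
      (≈-trans (sumUpTo-single d (d + e) (ℕ.m≤m+n d e) (λ a a≤ a≢d →
                  [ (λ x≈0 → ≈-trans (*-cong x≈0 ≈-refl) (zeroˡ _)) , (λ y≈0 → ≈-trans (*-cong ≈-refl y≈0) (zeroʳ _)) ]′
                  (h a a≤ a≢d)))
               (*-cong ≈-refl (≈-reflexive (≡.cong (λ t → coef t y) (ℕ.m+n∸m≡n d e)))))

    coef-*-top : ∀ {d e} x y → HasDegree≤ d x → HasDegree≤ e y → Eq n (coef (d + e) (x ⊗′ y)) (coef d x ⊗ coef e y)
    coef-*-top {d} {e} x y dx dy = coef-*-single d e x y (λ a a≤ a≢d → vanish a a≤ a≢d (ℕ.<-cmp a d))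
      where
      vanish : ∀ a → a ≤ d + e → ¬ a ≡ d → _ → Eq n (coef a x) 𝟘 ⊎ Eq n (coef (d + e ∸ a) y) 𝟘
      vanish a a≤ a≢d (tri< a<d _ _) =
        inj₂ (dy (d + e ∸ a) (≡.subst (_< d + e ∸ a) (ℕ.m+n∸m≡n d e) (ℕ.∸-monoʳ-< a<d (ℕ.m≤m+n d e))))
      vanish a a≤ a≢d (tri≈ _ a≡d _) = ⊥-elim (a≢d a≡d)
      vanish a a≤ a≢d (tri> _ _ d<a) = inj₁ (dx a d<a)

    coef-*-bottom : ∀ {d e} x y → VanishesBelow d x → VanishesBelow e y →
                    Eq n (coef (d + e) (x ⊗′ y)) (coef d x ⊗ coef e y)
    coef-*-bottom {d} {e} x y vx vy = coef-*-single d e x y (λ a a≤ a≢d → vanish a a≤ a≢d (ℕ.<-cmp a d))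
      where
      vanish : ∀ a → a ≤ d + e → ¬ a ≡ d → _ → Eq n (coef a x) 𝟘 ⊎ Eq n (coef (d + e ∸ a) y) 𝟘
      vanish a a≤ a≢d (tri< a<d _ _) = inj₁ (vx a a<d)
      vanish a a≤ a≢d (tri≈ _ a≡d _) = ⊥-elim (a≢d a≡d)
      vanish a a≤ a≢d (tri> _ _ d<a) =
        inj₂ (vy (d + e ∸ a) (≡.subst (d + e ∸ a <_) (ℕ.m+n∸m≡n d e) (ℕ.∸-monoʳ-< d<a a≤)))

    *-degree≤ : ∀ {d e} x y → HasDegree≤ d x → HasDegree≤ e y → HasDegree≤ (d + e) (x ⊗′ y)
    *-degree≤ {d} {e} x y dx dy j d+e<j = ≈-trans (coef-* j x y) (sumUpTo-zero j vanish)
      where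
      vanish : ∀ a → a ≤ j → Eq n (coef a x ⊗ coef (j ∸ a) y) 𝟘
      vanish a a≤j with a ℕ.≤? d
      ... | yes a≤d = ≈-trans (*-cong ≈-refl (dy (j ∸ a) e<j∸a)) (zeroʳ _)
        where
        e<j∸a : e < j ∸ a
        e<j∸a = ℕ.m+n≤o⇒m≤o∸n (suc e)
                  (≡.subst (_≤ j) (≡.cong suc (ℕ.+-comm a e)) (ℕ.≤-<-trans (ℕ.+-monoˡ-≤ e a≤d) d+e<j))
      ... | no a≰d = ≈-trans (*-cong (dx a (ℕ.≰⇒> a≰d)) ≈-refl) (zeroˡ _)

    +-degree≤ : ∀ {d} x y → HasDegree≤ d x → HasDegree≤ d y → HasDegree≤ d (addP (suc n) x y)
    +-degree≤ x y dx dy j d<j = ≈-trans (coef-+ j x y) (≈-trans (+-cong (dx j d<j) (dy j d<j)) (+-identityˡ 𝟘))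

    neg-degree≤ : ∀ {d} x → HasDegree≤ d x → HasDegree≤ d (negP (suc n) x)
    neg-degree≤ x dx j d<j = ≈-trans (coef-neg j x) (≈-trans (neg-cong (dx j d<j)) neg-0)

    ∂-degree≤ : ∀ {d} (i : Fin n) x → HasDegree≤ d x → HasDegree≤ d (∂ (suc i) x)
    ∂-degree≤ i x dx j d<j = ≈-trans (coef-∂-suc i j x) (≈-trans (∂-cong i (dx j d<j)) (∂-0 i))

    Δ-degree≤2 : ∀ i j g → HasDegree≤ 1 g → HasDegree≤ 2 (Δ (suc i) (suc j) g)
    Δ-degree≤2 i j g dg =
      +-degree≤ (gᵢ ⊗′ gⱼ) _ (*-degree≤ gᵢ gⱼ (∂-degree≤ i g dg) (∂-degree≤ j g dg))
                (neg-degree≤ (gᵢⱼ ⊗′ g) (*-degree≤ gᵢⱼ g (∂-degree≤ i gⱼ (∂-degree≤ j g dg)) dg))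
      where
      gᵢ  = ∂ (suc i) g
      gⱼ  = ∂ (suc j) g
      gᵢⱼ = ∂ (suc i) gⱼ

    coef-Δ : ∀ k i j g →
      Eq n (coef (k + k) (∂ (suc i) g ⊗′ ∂ (suc j) g)) (coef k (∂ (suc i) g) ⊗ coef k (∂ (suc j) g)) →
      Eq n (coef (k + k) (∂ (suc i) (∂ (suc j) g) ⊗′ g)) (coef k (∂ (suc i) (∂ (suc j) g)) ⊗ coef k g) →
      Eq n (coef (k + k) (Δ (suc i) (suc j) g)) (Δ i j (coef k g))
    coef-Δ k i j g top₁ top₂ =
      ≈-trans (coef-+ (k + k) (gᵢ ⊗′ gⱼ) (negP (suc n) (gᵢⱼ ⊗′ g)))
      (+-cong (≈-trans top₁ (*-cong (coef-∂-suc i k g) (coef-∂-suc j k g)))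
              (≈-trans (coef-neg (k + k) (gᵢⱼ ⊗′ g))
                       (neg-cong (≈-trans top₂ (*-cong (≈-trans (coef-∂-suc i k gⱼ) (∂-cong i (coef-∂-suc j k g))) ≈-refl)))))
      where
      gᵢ  = ∂ (suc i) g
      gⱼ  = ∂ (suc j) g
      gᵢⱼ = ∂ (suc i) gⱼ

    coef-sumOfSquares : ∀ k qs → (∀ {q} → q ∈ qs → Eq n (coef (k + k) (q ⊗′ q)) (coef k q ⊗ coef k q)) →
                        Eq n (coef (k + k) (sumOfSquares (suc n) qs)) (sumOfSquares n (map (coef k) qs))
    coef-sumOfSquares k qs sq = begin
      coef (k + k) (sumOfSquares (suc n) qs)            ≈⟨ coef-sumP n (λ q → q ⊗′ q) qs (k + k) ⟩
      sumP n (map (λ q → coef (k + k) (q ⊗′ q)) qs)   ≈⟨ sumP-cong n {f = λ q → coef (k + k) (q ⊗′ q)} qs sq ⟩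
      sumP n (map (λ q → coef k q ⊗ coef k q) qs)     ≡⟨ sumOfSquares-map (suc n) n (coef k) qs ⟩
      sumOfSquares n (map (coef k) qs)                 ∎

    coef-IsSOS : ∀ k p (sos : IsSOS {suc n} p) →
                 (∀ {q} → q ∈ proj₁ sos → Eq n (coef (k + k) (q ⊗′ q)) (coef k q ⊗ coef k q)) →
                 IsSOS {n} (coef (k + k) p)
    coef-IsSOS k p (qs , p≈) sq =
      map (coef k) qs , ⟪ ≈-trans (coef-cong {p} {sumOfSquares (suc n) qs} ⟦ p≈ ⟧ (k + k)) (coef-sumOfSquares k qs sq) ⟫

    coef-vanishes : FormallyReal n → ∀ k qs →
                    (∀ {q} → q ∈ qs → Eq n (coef (k + k) (q ⊗′ q)) (coef k q ⊗ coef k q)) →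
                    Eq n (coef (k + k) (sumOfSquares (suc n) qs)) 𝟘 → ∀ {q} → q ∈ qs → Eq n (coef k q) 𝟘
    coef-vanishes real k qs sq s≈0 q∈qs =
      real (map (coef k) qs) (≈-trans (≈-sym (coef-sumOfSquares k qs sq)) s≈0) (∈-map⁺ (coef k) q∈qs)

    -- The lowest nonzero coefficients of the qᵢ would give a nonzero
    -- sum of squares as a coefficient of Σ qᵢ².
    formallyReal-suc : FormallyReal n → FormallyReal (suc n)
    formallyReal-suc real qs s≈0 {q} q∈qs = coef-ext q [] (λ m → vanishesBelow (suc m) q∈qs m (ℕ.n<1+n m))
      where
      vanishesBelow : ∀ k {q} → q ∈ qs → VanishesBelow k q
      vanishesBelow zero    q∈ j ()
      vanishesBelow (suc k) q∈ j j<1+k with ℕ.m≤n⇒m<n∨m≡n (ℕ.≤-pred j<1+k)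
      ... | inj₁ j<k  = vanishesBelow k q∈ j j<k
      ... | inj₂ refl = coef-vanishes real k qs
                          (λ {q′} q∈′ → coef-*-bottom q′ q′ (vanishesBelow k q∈′) (vanishesBelow k q∈′))
                                      (coef-cong {sumOfSquares (suc n) qs} {[]} s≈0 (k + k)) q∈

    coef-beyond-length : ∀ p j → length p ≤ j → coef j p ≡ 𝟘
    coef-beyond-length []      j       _         = refl
    coef-beyond-length (a ∷ p) (suc j) (s≤s le) = coef-beyond-length p j le

    -- The highest coefficients of the qᵢ contribute a sum of squares to the
    -- coefficient of Σ qᵢ² in twice their degree, which therefore vanishes.
    sumOfSquares-degree≤ : FormallyReal n → ∀ d qs → HasDegree≤ (d + d) (sumOfSquares (suc n) qs) →
                           ∀ {q} → q ∈ qs → HasDegree≤ d q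
    sumOfSquares-degree≤ real d qs s≤ = descend (sum (map length qs)) lengthBound
      where
      lengthBound : ∀ {q} → q ∈ qs → HasDegree≤ (sum (map length qs) + d) q
      lengthBound {q} q∈ j lt = ≈-reflexive (coef-beyond-length q j
        (ℕ.≤-trans (length≤sum-lengths q∈) (ℕ.≤-trans (ℕ.m≤m+n _ d) (ℕ.<⇒≤ lt))))
      descend : ∀ k → (∀ {q} → q ∈ qs → HasDegree≤ (k + d) q) → ∀ {q} → q ∈ qs → HasDegree≤ d q
      descend zero    h = h
      descend (suc k) h = descend k (λ q∈ j k+d<j → lower q∈ j (ℕ.m≤n⇒m<n∨m≡n k+d<j))
        where
        t = suc (k + d)
        d+d<t+t : d + d < t + t
        d+d<t+t = ℕ.+-mono-< (s≤s (ℕ.m≤n+m d k)) (s≤s (ℕ.m≤n+m d k))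
        lower : ∀ {q} → q ∈ qs → ∀ j → t < j ⊎ t ≡ j → Eq n (coef j q) 𝟘
        lower q∈ j (inj₁ t<j)  = h q∈ j t<j
        lower q∈ j (inj₂ refl) =
          coef-vanishes real t qs (λ {q′} q∈′ → coef-*-top q′ q′ (h q∈′) (h q∈′)) (s≤ (t + t) d+d<t+t) q∈

    SOSRayleigh-coef-zero : ∀ g → (∀ i j → IsSOS {suc n} (Δ (suc i) (suc j) g)) → SOSRayleigh n (coef 0 g)
    SOSRayleigh-coef-zero g sos i j =
      IsSOS-resp n (≈-sym (coef-Δ 0 i j g (coef-* 0 (∂ (suc i) g) (∂ (suc j) g)) (coef-* 0 (∂ (suc i) (∂ (suc j) g)) g)))
                   (coef-IsSOS 0 (Δ (suc i) (suc j) g) (sos i j) (λ {q} _ → coef-* 0 q q))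

    SOSRayleigh-coef-one : FormallyReal n → ∀ g → HasDegree≤ 1 g →
                           (∀ i j → IsSOS {suc n} (Δ (suc i) (suc j) g)) → SOSRayleigh n (coef 1 g)
    SOSRayleigh-coef-one real g dg sos i j =
      IsSOS-resp n (≈-sym (coef-Δ 1 i j g (coef-*-top gᵢ gⱼ (∂-degree≤ i g dg) (∂-degree≤ j g dg))
                                          (coef-*-top gᵢⱼ g (∂-degree≤ i gⱼ (∂-degree≤ j g dg)) dg)))
                   (coef-IsSOS 1 (Δ (suc i) (suc j) g) (sos i j) (λ {q} q∈ → coef-*-top q q (linear q∈) (linear q∈)))
      where
      gᵢ  = ∂ (suc i) g
      gⱼ  = ∂ (suc j) g
      gᵢⱼ = ∂ (suc i) gⱼ
      qs  = proj₁ (sos i j)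
      linear : ∀ {q} → q ∈ qs → HasDegree≤ 1 q
      linear = sumOfSquares-degree≤ real 1 qs (λ m 2<m →
        ≈-trans (≈-sym (coef-cong {Δ (suc i) (suc j) g} {sumOfSquares (suc n) qs} ⟦ proj₂ (sos i j) ⟧ m))
                (Δ-degree≤2 i j g dg m 2<m))

  SOSRayleigh-resp : ∀ n {p q} → Eq n p q → SOSRayleigh n q → SOSRayleigh n p
  SOSRayleigh-resp n p≈q sos i j = IsSOS-resp n (Δ-cong n i j p≈q) (sos i j)

  -- Real fields are formally real

  module RealField (F : IsRealField R) where
    open IsRealField F using (≤-trans; ≤-antisym; ≤-total; ≤-resp-≈; +-mono-≤; *-nonneg; 0≉1; inverse; complete)
      renaming (_≤_ to _≤ᵣ_)
    open CommutativeRing R using (Carrier; 0#; 1#; -_; _≈_; sym; trans; +-cong; *-cong; +-assoc; +-comm;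
      +-identityˡ; +-identityʳ; -‿inverseˡ; -‿inverseʳ; distribˡ; distribʳ; *-identityˡ; *-identityʳ; zeroˡ; -‿cong)
      renaming (refl to ≈-refl; _+_ to _⊕_; _*_ to _⊗_)
    open import Algebra.Properties.Ring (CommutativeRing.ring R)
      using (-‿distribˡ-*; -‿distribʳ-*; -‿involutive; -‿+-comm)

    x≤y⇒0≤y-x : ∀ {x y} → x ≤ᵣ y → 0# ≤ᵣ (y ⊕ (- x))
    x≤y⇒0≤y-x {x} le = ≤-resp-≈ (-‿inverseʳ x) ≈-refl (+-mono-≤ (- x) le)

    0≤y-x⇒x≤y : ∀ {x y} → 0# ≤ᵣ (y ⊕ (- x)) → x ≤ᵣ y
    0≤y-x⇒x≤y {x} {y} le = ≤-resp-≈ (+-identityˡ x)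
      (trans (+-assoc y (- x) x) (trans (+-cong ≈-refl (-‿inverseˡ x)) (+-identityʳ y)))
      (+-mono-≤ x le)

    x≤0⇒0≤-x : ∀ {x} → x ≤ᵣ 0# → 0# ≤ᵣ (- x)
    x≤0⇒0≤-x le = ≤-resp-≈ ≈-refl (+-identityˡ _) (x≤y⇒0≤y-x le)

    0≤-x⇒x≤0 : ∀ {x} → 0# ≤ᵣ (- x) → x ≤ᵣ 0#
    0≤-x⇒x≤0 le = 0≤y-x⇒x≤y (≤-resp-≈ ≈-refl (sym (+-identityˡ _)) le)

    -x*-x≈x*x : ∀ x → ((- x) ⊗ (- x)) ≈ (x ⊗ x)
    -x*-x≈x*x x = trans (sym (-‿distribˡ-* x (- x))) (trans (-‿cong (sym (-‿distribʳ-* x x))) (-‿involutive (x ⊗ x)))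

    0≤x*x : ∀ x → 0# ≤ᵣ (x ⊗ x)
    0≤x*x x with ≤-total 0# x
    ... | inj₁ 0≤x = *-nonneg 0≤x 0≤x
    ... | inj₂ x≤0 = ≤-resp-≈ ≈-refl (-x*-x≈x*x x) (*-nonneg (x≤0⇒0≤-x x≤0) (x≤0⇒0≤-x x≤0))

    0≤1 : 0# ≤ᵣ 1#
    0≤1 = ≤-resp-≈ ≈-refl (*-identityˡ 1#) (0≤x*x 1#)

    0≤x+y : ∀ {x y} → 0# ≤ᵣ x → 0# ≤ᵣ y → 0# ≤ᵣ (x ⊕ y)
    0≤x+y {x} {y} 0≤x 0≤y = ≤-trans 0≤y (≤-resp-≈ (+-identityˡ y) ≈-refl (+-mono-≤ y 0≤x))

    x≤x+y : ∀ {x y} → 0# ≤ᵣ y → x ≤ᵣ (x ⊕ y)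
    x≤x+y {x} {y} 0≤y = ≤-resp-≈ (+-identityˡ x) (+-comm y x) (+-mono-≤ x 0≤y)

    x+y≈0⇒x≈0 : ∀ {x y} → 0# ≤ᵣ x → 0# ≤ᵣ y → (x ⊕ y) ≈ 0# → x ≈ 0#
    x+y≈0⇒x≈0 0≤x 0≤y x+y≈0 = ≤-antisym (≤-resp-≈ ≈-refl x+y≈0 (x≤x+y 0≤y)) 0≤x

    2≉0 : ¬ ((1# ⊕ 1#) ≈ 0#)
    2≉0 2≈0 = 0≉1 (sym (x+y≈0⇒x≈0 0≤1 0≤1 2≈0))

    half : Σ Carrier λ h → 0# ≤ᵣ h × (h ⊕ h) ≈ 1#
    half = h , 0≤h , h+h≈1
      where
      h = proj₁ (inverse (1# ⊕ 1#) 2≉0)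
      h+h≈1 : (h ⊕ h) ≈ 1#
      h+h≈1 = trans (sym (trans (distribʳ h 1# 1#) (+-cong (*-identityˡ h) (*-identityˡ h))))
                    (proj₂ (inverse (1# ⊕ 1#) 2≉0))
      0≤h : 0# ≤ᵣ h
      0≤h with ≤-total 0# h
      ... | inj₁ 0≤h = 0≤h
      ... | inj₂ h≤0 = ⊥-elim (0≉1 (sym (≤-antisym (0≤-x⇒x≤0 0≤-1) 0≤1)))
        where
        0≤-1 : 0# ≤ᵣ (- 1#)
        0≤-1 = ≤-resp-≈ ≈-refl (trans (-‿+-comm h h) (-‿cong h+h≈1)) (0≤x+y (x≤0⇒0≤-x h≤0) (x≤0⇒0≤-x h≤0))

    Nilsquare : Carrier → Set _
    Nilsquare x = (x ⊗ x) ≈ 0#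

    nilsquare≤1 : ∀ x → Nilsquare x → x ≤ᵣ 1#
    nilsquare≤1 x x²≈0 with ≤-total x 1#
    ... | inj₁ x≤1 = x≤1
    ... | inj₂ 1≤x = ≤-trans (0≤-x⇒x≤0 (≤-resp-≈ ≈-refl x[x-1]≈-x (*-nonneg (≤-trans 0≤1 1≤x) (x≤y⇒0≤y-x 1≤x)))) 0≤1
      where
      x[x-1]≈-x : (x ⊗ (x ⊕ (- 1#))) ≈ (- x)
      x[x-1]≈-x = trans (distribˡ x x (- 1#))
        (trans (+-cong x²≈0 (trans (sym (-‿distribʳ-* x 1#)) (-‿cong (*-identityʳ x)))) (+-identityˡ (- x)))

    nilsquare-double : ∀ x → Nilsquare x → Nilsquare (x ⊕ x)
    nilsquare-double x x²≈0 = trans (distribˡ (x ⊕ x) x x) (trans (+-cong 2x*x≈0 2x*x≈0) (+-identityˡ 0#))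
      where
      2x*x≈0 : ((x ⊕ x) ⊗ x) ≈ 0#
      2x*x≈0 = trans (distribʳ x x x) (trans (+-cong x²≈0 x²≈0) (+-identityˡ 0#))

    -- Constructively, x² ≈ 0 only refutes x ≉ 0.  Instead, the nilsquares
    -- are bounded by 1 and closed under doubling, so their supremum s
    -- satisfies s ≤ s/2, hence s ≤ 0; and both x and -x are nilsquares.
    x*x≈0⇒x≈0 : ∀ x → Nilsquare x → x ≈ 0#
    x*x≈0⇒x≈0 x x²≈0 = ≤-antisym (≤-trans (upper x x²≈0) s≤0)
      (≤-resp-≈ ≈-refl (-‿involutive x) (x≤0⇒0≤-x (≤-trans (upper (- x) (trans (-x*-x≈x*x x) x²≈0)) s≤0)))
      where
      supremum = complete Nilsquare (0# , zeroˡ 0#) (1# , nilsquare≤1)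
      s     = proj₁ supremum
      upper = proj₁ (proj₂ supremum)
      least = proj₂ (proj₂ supremum)
      h     = proj₁ half
      0≤h   = proj₁ (proj₂ half)
      h+h≈1 = proj₂ (proj₂ half)
      h[y+y]≈y : ∀ y → (h ⊗ (y ⊕ y)) ≈ y
      h[y+y]≈y y = trans (distribˡ h y y) (trans (sym (distribʳ y h h)) (trans (*-cong h+h≈1 ≈-refl) (*-identityˡ y)))
      y≤hs : ∀ y → Nilsquare y → y ≤ᵣ (h ⊗ s)
      y≤hs y y²≈0 = 0≤y-x⇒x≤y (≤-resp-≈ ≈-refl h[s-2y]≈hs-y
                      (*-nonneg 0≤h (x≤y⇒0≤y-x (upper (y ⊕ y) (nilsquare-double y y²≈0)))))
        where
        h[s-2y]≈hs-y : (h ⊗ (s ⊕ (- (y ⊕ y)))) ≈ ((h ⊗ s) ⊕ (- y))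
        h[s-2y]≈hs-y = trans (distribˡ h s (- (y ⊕ y))) (+-cong ≈-refl (trans (sym (-‿distribʳ-* h (y ⊕ y))) (-‿cong (h[y+y]≈y y))))
      t = h ⊗ s
      s≈t+t : s ≈ (t ⊕ t)
      s≈t+t = sym (trans (sym (distribʳ s h h)) (trans (*-cong h+h≈1 ≈-refl) (*-identityˡ s)))
      s≤t : s ≤ᵣ t
      s≤t = least t y≤hs
      t≤0 : t ≤ᵣ 0#
      t≤0 = ≤-resp-≈ (trans (+-assoc t t (- t)) (trans (+-cong ≈-refl (-‿inverseʳ t)) (+-identityʳ t))) (-‿inverseʳ t)
                     (+-mono-≤ (- t) (≤-resp-≈ s≈t+t ≈-refl s≤t))
      s≤0 : s ≤ᵣ 0#
      s≤0 = ≤-trans s≤t t≤0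

    0≤sumOfSquares : ∀ qs → 0# ≤ᵣ sumOfSquares zero qs
    0≤sumOfSquares []       = IsRealField.≤-refl F
    0≤sumOfSquares (q ∷ qs) = 0≤x+y (0≤x*x q) (0≤sumOfSquares qs)

    formallyReal-zero : FormallyReal zero
    formallyReal-zero (q ∷ qs) s≈0 (here refl) =
      ⟦ x*x≈0⇒x≈0 q (x+y≈0⇒x≈0 (0≤x*x q) (0≤sumOfSquares qs) ⟪ s≈0 ⟫) ⟧
    formallyReal-zero (q ∷ qs) s≈0 (there q∈) =
      formallyReal-zero qs ⟦ x+y≈0⇒x≈0 (0≤sumOfSquares qs) (0≤x*x q) (trans (+-comm _ _) ⟪ s≈0 ⟫) ⟧ q∈

  -- Basis polynomials of deletions and contractions

  monomial : ∀ {n} → Subset n → Poly n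
  monomial {zero}  []          = CR.1#
  monomial {suc n} (true  ∷ B) = 0P n ∷ monomial B ∷ []
  monomial {suc n} (false ∷ B) = monomial B ∷ []

  filter-∈-map-suc : ∀ {n} b (B : Subset n) (is : List (Fin n)) →
                     filter (_∈? (b ∷ B)) (map suc is) ≡ map suc (filter (_∈? B) is)
  filter-∈-map-suc b B []       = refl
  filter-∈-map-suc b B (i ∷ is) with does (i ∈? B)
  ... | true  = ≡.cong (suc i ∷_) (filter-∈-map-suc b B is)
  ... | false = filter-∈-map-suc b B is

  elements-∷ : ∀ {n} b (B : Subset n) →
               elements (b ∷ B) ≡ (if b then zero ∷ map suc (elements B) else map suc (elements B))
  elements-∷ {n} b B =
    ≡.trans (≡.cong (λ is → filter (_∈? (b ∷ B)) (zero ∷ is)) (≡.sym (Data.List.Properties.map-tabulate (λ i → i) suc)))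
            (filter-zero∷ b)
    where
    filter-zero∷ : ∀ b → filter (_∈? (b ∷ B)) (zero ∷ map suc (allFin n)) ≡
                         (if b then zero ∷ map suc (elements B) else map suc (elements B))
    filter-zero∷ true  = ≡.cong (zero ∷_) (filter-∈-map-suc true B (allFin n))
    filter-zero∷ false = filter-∈-map-suc false B (allFin n)

  prodVars : ∀ n → List (Fin n) → Poly n
  prodVars n is = prodP n (map var is)

  prodVars-map-suc : ∀ n (is : List (Fin n)) → Eq (suc n) (prodVars (suc n) (map suc is)) (prodVars n is ∷ [])
  prodVars-map-suc n []       = PolyProps.≈-refl (suc n)
  prodVars-map-suc n (i ∷ is) =
    PolyProps.≈-trans (suc n) (PolyProps.*-cong (suc n) (PolyProps.≈-refl (suc n) {var {suc n} (suc i)}) (prodVars-map-suc n is))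
                              ⟦ ⟪ PolyProps.+-identityʳ n (mulP n (var i) (prodVars n is)) ⟫ , tt ⟧

  x₀-* : ∀ n {p q : Poly n} → Eq n p q → Eq (suc n) (mulP (suc n) (var {suc n} zero) (p ∷ [])) (0P n ∷ q ∷ [])
  x₀-* n {p} p≈q =
    ⟦ ⟪ ≈-trans (+-cong (zeroˡ p) ≈-refl) (+-identityˡ (0P n)) ⟫
    , ⟪ ≈-trans (+-identityʳ (mulP n (1P n) p)) (≈-trans (*-identityˡ p) p≈q) ⟫ , tt ⟧
    where open PolyProps n

  prodVars-elements : ∀ n (B : Subset n) → Eq n (prodVars n (elements B)) (monomial B)
  prodVars-elements zero    []          = PolyProps.≈-refl zero
  prodVars-elements (suc n) (true ∷ B)  =
    ≈-trans (≈-reflexive (≡.cong (prodVars (suc n)) (elements-∷ true B)))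
    (≈-trans (*-cong (≈-refl {var {suc n} zero}) (prodVars-map-suc n (elements B))) (x₀-* n (prodVars-elements n B)))
    where open PolyProps (suc n)
  prodVars-elements (suc n) (false ∷ B) =
    ≈-trans (≈-reflexive (≡.cong (prodVars (suc n)) (elements-∷ false B)))
    (≈-trans (prodVars-map-suc n (elements B)) ⟦ ⟪ prodVars-elements n B ⟫ , tt ⟧)
    where open PolyProps (suc n)

  basisPoly-map : ∀ {m} n (f : Subset m → Subset n) Bs →
                  Eq n (basisPoly (map f Bs)) (sumP n (map (λ B → monomial (f B)) Bs))
  basisPoly-map n f []       = PolyProps.≈-refl n
  basisPoly-map n f (B ∷ Bs) = PolyProps.+-cong n (prodVars-elements n (f B)) (basisPoly-map n f Bs)

  frontMonomial : ∀ {n} → Fin (suc n) → Subset (suc n) → Poly (suc n)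
  frontMonomial {n} e B = if does (e ∈? B) then 0P n ∷ monomial (removeAt B e) ∷ []
                                          else monomial (removeAt B e) ∷ []

  toFront-monomial : ∀ {n} (e : Fin (suc n)) (B : Subset (suc n)) → Eq (suc n) (toFront e (monomial B)) (frontMonomial e B)
  toFront-monomial         zero    (true  ∷ B)      = PolyProps.≈-refl _
  toFront-monomial         zero    (false ∷ B)      = PolyProps.≈-refl _
  toFront-monomial {suc n} (suc e) (false ∷ b ∷ B) =
    PolyProps.≈-trans (suc (suc n))
      (IsPolyHom.cong (Swap.swap-isPolyHom n) {map (toFront e) (monomial (false ∷ b ∷ B))} {frontMonomial e (b ∷ B) ∷ []}
                      ⟦ ⟪ toFront-monomial e (b ∷ B) ⟫ , tt ⟧)
      (swap-singleton (does (e ∈? (b ∷ B))))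
    where
    m = monomial (false ∷ removeAt (b ∷ B) e)
    swap-singleton : ∀ c → Eq (suc (suc n))
      (swap₀₁ n ((if c then 0P n ∷ monomial (removeAt (b ∷ B) e) ∷ [] else monomial (removeAt (b ∷ B) e) ∷ []) ∷ []))
      (if c then 0P (suc n) ∷ m ∷ [] else m ∷ [])
    swap-singleton true  = ⟦ (⟪ PolyProps.≈-refl n ⟫ , tt) , (⟪ PolyProps.≈-refl n ⟫ , tt) , tt ⟧
    swap-singleton false = PolyProps.≈-refl (suc (suc n))
  toFront-monomial {suc n} (suc e) (true ∷ b ∷ B) =
    PolyProps.≈-trans (suc (suc n))
      (IsPolyHom.cong (Swap.swap-isPolyHom n) {map (toFront e) (monomial (true ∷ b ∷ B))} {[] ∷ frontMonomial e (b ∷ B) ∷ []}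
                      ⟦ ⟪ IsPolyHom.0#-homo (toFront-isPolyHom e) ⟫ , ⟪ toFront-monomial e (b ∷ B) ⟫ , tt ⟧)
      (swap-pair (does (e ∈? (b ∷ B))))
    where
    m = monomial (true ∷ removeAt (b ∷ B) e)
    swap-pair : ∀ c → Eq (suc (suc n))
      (swap₀₁ n ([] ∷ (if c then 0P n ∷ monomial (removeAt (b ∷ B) e) ∷ [] else monomial (removeAt (b ∷ B) e) ∷ []) ∷ []))
      (if c then 0P (suc n) ∷ m ∷ [] else m ∷ [])
    swap-pair true  = ⟦ (⟪ PolyProps.≈-refl n ⟫ , ⟪ PolyProps.≈-refl n ⟫ , tt)
                      , (⟪ PolyProps.≈-refl n ⟫ , ⟪ PolyProps.≈-refl n ⟫ , tt) , tt ⟧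
    swap-pair false = PolyProps.≈-refl (suc (suc n))

  basisPoly≈monomials : ∀ n (Bs : List (Subset n)) → Eq n (basisPoly Bs) (sumP n (map monomial Bs))
  basisPoly≈monomials n Bs = sumP-cong n Bs (λ {B} _ → prodVars-elements n B)

  module FrontBasis {n} (e : Fin (suc n)) where
    open PolyProps n
    open Degree n using (HasDegree≤)

    removeₑ : Subset (suc n) → Subset n
    removeₑ B = removeAt B e

    coef-zero-frontMonomials : ∀ Bs → Eq n (sumP n (map (λ B → coef 0 (frontMonomial e B)) Bs))
                                           (sumP n (map (monomial ∘ removeₑ) (filter (λ B → ¬? (e ∈? B)) Bs)))
    coef-zero-frontMonomials []       = ≈-refl
    coef-zero-frontMonomials (B ∷ Bs) with does (e ∈? B)
    ... | true  = ≈-trans (+-identityˡ _) (coef-zero-frontMonomials Bs)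
    ... | false = +-cong ≈-refl (coef-zero-frontMonomials Bs)

    coef-one-frontMonomials : ∀ Bs → Eq n (sumP n (map (λ B → coef 1 (frontMonomial e B)) Bs))
                                          (sumP n (map (monomial ∘ removeₑ) (filter (e ∈?_) Bs)))
    coef-one-frontMonomials []       = ≈-refl
    coef-one-frontMonomials (B ∷ Bs) with does (e ∈? B)
    ... | true  = +-cong ≈-refl (coef-one-frontMonomials Bs)
    ... | false = ≈-trans (+-identityˡ _) (coef-one-frontMonomials Bs)

    frontMonomial-degree≤1 : ∀ B → HasDegree≤ 1 (frontMonomial e B)
    frontMonomial-degree≤1 B (suc zero)    (s≤s ())
    frontMonomial-degree≤1 B (suc (suc j)) _ with does (e ∈? B)
    ... | true  = ≈-refl
    ... | false = ≈-refl

    module _ (M : List (Subset (suc n))) where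
      front : Poly (suc n)
      front = toFront e (basisPoly M)

      coef-front : ∀ k → Eq n (coef k front) (sumP n (map (λ B → coef k (frontMonomial e B)) M))
      coef-front k = ≈-trans (coef-cong {front} {sumP (suc n) (map (frontMonomial e) M)} front≈ k)
                             (coef-sumP n (frontMonomial e) M k)
        where
        open IsPolyHom (toFront-isPolyHom e)
        front≈ : Eq (suc n) front (sumP (suc n) (map (frontMonomial e) M))
        front≈ = PolyProps.≈-trans (suc n) (cong (basisPoly≈monomials (suc n) M))
                 (PolyProps.≈-trans (suc n) (hom-sumP (toFront-isPolyHom e) monomial M)
                                            (sumP-cong (suc n) M (λ {B} _ → toFront-monomial e B)))

      coef-zero-front : Eq n (coef 0 front) (basisPoly (map removeₑ (filter (λ B → ¬? (e ∈? B)) M)))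
      coef-zero-front = ≈-trans (coef-front 0) (≈-trans (coef-zero-frontMonomials M)
                                (≈-sym (basisPoly-map n removeₑ (filter (λ B → ¬? (e ∈? B)) M))))

      coef-one-front : Eq n (coef 1 front) (basisPoly (map removeₑ (filter (e ∈?_) M)))
      coef-one-front = ≈-trans (coef-front 1) (≈-trans (coef-one-frontMonomials M)
                               (≈-sym (basisPoly-map n removeₑ (filter (e ∈?_) M))))

      front-degree≤1 : HasDegree≤ 1 front
      front-degree≤1 j 1<j = ≈-trans (coef-front j) (sumP-zero n M (λ {B} _ → frontMonomial-degree≤1 B j 1<j))

      SOSRayleigh-coef-zero-front : SOSRayleighMatroid M → SOSRayleigh n (coef 0 front)
      SOSRayleigh-coef-zero-front sos =
        Degree.SOSRayleigh-coef-zero n front (toFront-Δ-IsSOS e (basisPoly M) sos)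

      SOSRayleigh-coef-one-front : FormallyReal n → SOSRayleighMatroid M → SOSRayleigh n (coef 1 front)
      SOSRayleigh-coef-one-front real sos =
        Degree.SOSRayleigh-coef-one n real front front-degree≤1 (toFront-Δ-IsSOS e (basisPoly M) sos)


  deletion-SOSRayleigh : ∀ {n} → FormallyReal n → ∀ (e : Fin (suc n)) M →
                         SOSRayleighMatroid M → SOSRayleighMatroid (deletion e M)
  deletion-SOSRayleigh {n} real e M sos with all? (e ∈?_) M
  ... | yes all∈ = SOSRayleigh-resp n (PolyProps.≈-sym n coef-one) (SOSRayleigh-coef-one-front M real sos)
    where
    open FrontBasis e
    coef-one : Eq n (PolyProps.coef n 1 (front M)) (basisPoly (map removeₑ M))
    coef-one = ≡.subst (λ Bs → Eq n (PolyProps.coef n 1 (front M)) (basisPoly (map removeₑ Bs)))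
                       (Data.List.Properties.filter-all (e ∈?_) all∈) (coef-one-front M)
  ... | no _ = SOSRayleigh-resp n (PolyProps.≈-sym n (coef-zero-front M)) (SOSRayleigh-coef-zero-front M sos)
    where open FrontBasis e

  contraction-SOSRayleigh : ∀ {n} → FormallyReal n → ∀ (e : Fin (suc n)) M →
                            SOSRayleighMatroid M → SOSRayleighMatroid (contraction e M)
  contraction-SOSRayleigh {n} real e M sos with all? (λ B → ¬? (e ∈? B)) M
  ... | yes all∉ = SOSRayleigh-resp n (PolyProps.≈-sym n coef-zero) (SOSRayleigh-coef-zero-front M sos)
    where
    open FrontBasis e
    coef-zero : Eq n (PolyProps.coef n 0 (front M)) (basisPoly (map removeₑ M))
    coef-zero = ≡.subst (λ Bs → Eq n (PolyProps.coef n 0 (front M)) (basisPoly (map removeₑ Bs)))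
                        (Data.List.Properties.filter-all (λ B → ¬? (e ∈? B)) all∉) (coef-zero-front M)
  ... | no _ = SOSRayleigh-resp n (PolyProps.≈-sym n (coef-one-front M)) (SOSRayleigh-coef-one-front M real sos)
    where open FrontBasis e

  minor-SOSRayleigh : (∀ n → FormallyReal n) → ∀ {m n} {N : List (Subset m)} {M : List (Subset n)} →
                      Minor N M → SOSRayleighMatroid M → SOSRayleighMatroid N
  minor-SOSRayleigh real here sos = sos
  minor-SOSRayleigh real (delete   {n = n} {M = M} e N≼M) sos =
    minor-SOSRayleigh real N≼M (deletion-SOSRayleigh (real n) e M sos)
  minor-SOSRayleigh real (contract {n = n} {M = M} e N≼M) sos =
    minor-SOSRayleigh real N≼M (contraction-SOSRayleigh (real n) e M sos)

  formallyReal : IsRealField R → ∀ n → FormallyReal n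
  formallyReal F zero    = RealField.formallyReal-zero F
  formallyReal F (suc n) = Degree.formallyReal-suc n (formallyReal F n)

corollary2p13 : ∀ {c ℓ} (ℝ : CommutativeRing c ℓ) → IsRealField ℝ →
                ∀ {m n} (M : List (Subset m)) (N : List (Subset n)) →
                IsMatroid M → Minor N M →
                BasisPolynomial.SOSRayleighMatroid ℝ M →
                BasisPolynomial.SOSRayleighMatroid ℝ N
corollary2p13 ℝ isReal M N _ N≼M = minor-SOSRayleigh ℝ (formallyReal ℝ isReal) N≼M
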